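{- Given a permutation $\lambda$ of $\{1,\ldots,n\}$ and a parent function $p:\{1,2,\ldots,n\}\rightarrow \{2,\ldots,n\}\cup\{\infty\}$ (with $p(i)>i$ for all $i$), the pair $(\lambda,p)$ is the largest maximal representation of the tournament induced by $(\lambda,p)$ if and only if for each descent $i$ of $\lambda$, the vertex $\lambda(i+1)$ belongs to the range of $p$.
   Context: A tournament $T$ on $\{1,\ldots,n\}$ has for every pair $\{i,j\}$ exactly one of the edges $i\rightarrow j$, $j\rightarrow i$; an edge $i\rightarrow j$ is an ascent if $i<j$ and a descent if $i>j$. $T$ is alternation acyclic if it has no directed cycle in which ascents and descents alternate. The right alternating walk order $\preceq$ induced by $T$ is defined by $u\preceq v$ if $u=v$ or there is a directed walk from $u$ to $v$ starting with a descent, ending with an ascent, in which descents and ascents alternate; for alternation acyclic $T$ it is a partial order. For a permutation $\pi$ and a parent function $p:\{1,\ldots,n\}\rightarrow\{2,\ldots,n\}\cup\{\infty\}$ with $p(i)>i$, the tournament induced by $(\pi,p)$ has, for all $u<v$, the edge $u\rightarrow v$ if $p(u)\neq\infty$ and $\pi^{ -1}(v)\geq\pi^{ -1}(p(u))$, and the edge $v\rightarrow u$ otherwise; this tournament is always alternation acyclic, and for every alternation acyclic $T$ and every linear extension $\pi$ of $\preceq$ there is a unique $p$ such that $(\pi,p)$ induces $T$. For an alternation acyclic tournament $T$, the largest maximal order is the permutation $\lambda$ such that for each $k$, $\lambda(k)$ is the largest maximal element of the restriction of $\preceq$ to $\{\lambda(1),\ldots,\lambda(k)\}$; the unique pair $(\lambda,p)$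 inducing $T$ is the largest maximal representation of $T$. An index $i$ is a descent of a permutation $\lambda$ if $\lambda(i)>\lambda(i+1)$. -}

module Defs where

open import Data.Nat using (ℕ; suc) renaming (_≤_ to _≤ℕ_)
open import Data.Fin using (Fin; toℕ; _<_; _≤_)
open import Data.Maybe using (Maybe; just)
open import Data.Product using (Σ; _×_; ∃)
open import Data.Sum using (_⊎_)
open import Relation.Nullary using (¬_)
open import Relation.Binary.PropositionalEquality using (_≡_)
open import Function.Bundles using (_↔_; Inverse)

-- Vertices {1,…,n} are represented by Fin n (0-indexed, order preserved).
-- A tournament is given by its edge relation: T u v means the edge u → v.

-- Parent function: p u ≡ nothing encodes p(u) = ∞.
Parent : ℕ → Set
Parent n = Fin n → Maybe (Fin n)

ParentValid : ∀ {n} → Parent n → Set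
ParentValid {n} p = ∀ (i j : Fin n) → p i ≡ just j → i < j

Forward : ∀ {n} → (Fin n ↔ Fin n) → Parent n → Fin n → Fin n → Set
Forward {n} π p u v =
  Σ (Fin n) λ j → (p u ≡ just j) × (Inverse.from π j ≤ Inverse.from π v)

Induced : ∀ {n} → (Fin n ↔ Fin n) → Parent n → Fin n → Fin n → Set
Induced π p x y = (x < y × Forward π p x y) ⊎ (y < x × ¬ Forward π p y x)

data AltWalk {n} (T : Fin n → Fin n → Set) : Fin n → Fin n → Set where
  last : ∀ {u w v} → T u w → w < u → T w v → w < v → AltWalk T u v
  more : ∀ {u w x v} → T u w → w < u → T w x → w < x → AltWalk T x v → AltWalk T u v

_⪯[_]_ : ∀ {n} → Fin n → (Fin n → Fin n → Set) → Fin n → Set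
u ⪯[ T ] v = u ≡ v ⊎ AltWalk T u v

IsMaximalIn : ∀ {n} → (Fin n → Fin n → Set) → (Fin n → Set) → Fin n → Set
IsMaximalIn {n} T S m = S m × (∀ (x : Fin n) → S x → m ⪯[ T ] x → x ≡ m)

IsLargestMaximalIn : ∀ {n} → (Fin n → Fin n → Set) → (Fin n → Set) → Fin n → Set
IsLargestMaximalIn {n} T S m =
  IsMaximalIn T S m × (∀ (m' : Fin n) → IsMaximalIn T S m' → m' ≤ m)

Prefix : ∀ {n} → (Fin n → Fin n) → Fin n → Fin n → Set
Prefix {n} l k x = Σ (Fin n) λ j → (j ≤ k) × (l j ≡ x)

IsLargestMaximalOrder : ∀ {n} → (Fin n → Fin n → Set) → (Fin n → Fin n) → Set
IsLargestMaximalOrder {n} T l = ∀ (k : Fin n) → IsLargestMaximalIn T (Prefix l k) (l k)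

IsLargestMaximalRepresentation : ∀ {n} → (Fin n ↔ Fin n) → Parent n → Set
IsLargestMaximalRepresentation π p = IsLargestMaximalOrder (Induced π p) (Inverse.to π)

DescentsInRange : ∀ {n} → (Fin n ↔ Fin n) → Parent n → Set
DescentsInRange {n} π p =
  ∀ (i j : Fin n) → toℕ j ≡ suc (toℕ i) → Inverse.to π j < Inverse.to π i →
  ∃ λ (u : Fin n) → p u ≡ just (Inverse.to π j)

module Submission where

open import Defs
open import Data.Nat using (ℕ)
open import Data.Fin using (Fin)
open import Function.Bundles using (_↔_; _⇔_)

open import Data.Nat as ℕ using (zero; suc; z≤n; s≤s)
import Data.Nat.Properties as ℕ
open import Data.Fin as Fin using (toℕ; fromℕ<)
import Data.Fin.Properties as Fin
open import Data.Maybe using (just)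
import Data.Maybe.Properties as Maybe
open import Data.Product using (_×_; ∃; ∃₂; _,_; proj₂)
open import Data.Sum using (inj₁; inj₂)
open import Data.Empty using (⊥-elim)
open import Relation.Nullary using (¬_; yes; no)
open import Relation.Nullary.Decidable using (_→-dec_)
open import Level using (0ℓ)
open import Relation.Unary using (Pred; Decidable)
open import Relation.Binary.PropositionalEquality
open import Function.Bundles using (Inverse; mk⇔)

-- Along an alternating walk u → w → x (descent then ascent) the
-- ascent w → x says λ⁻¹(p w) ≤ λ⁻¹(x), and the descent u → w says
-- λ⁻¹(u) < λ⁻¹(p w); so alternating walks move strictly forward in λ, passing a
-- vertex of the range of p. Hence λ(k) is always maximal in {λ(1),…,λ(k)}, and
-- λ(i) is maximal there exactly when no walk enters the prefix again. If λ has a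
-- descent at i with λ(i+1) ∉ range p, then λ(i) is a larger maximal element of
-- {λ(1),…,λ(i+1)} than λ(i+1). Conversely, a maximal λ(i) > λ(k) with i ≤ k is
-- ruled out by a t with i ≤ t < k and λ(t+1) < λ(i) ≤ λ(t): t is a descent, so
-- λ(t+1) = p u with u < λ(i), and λ(i) → u → λ(t+1) is an alternating walk.

crossing : (P : Pred ℕ 0ℓ) → Decidable P → ∀ {i k} → i ℕ.≤ k → P i → ¬ P k →
           ∃ λ t → i ℕ.≤ t × t ℕ.< k × P t × ¬ P (suc t)
crossing P P? {k = zero}  z≤n Pi ¬Pk = ⊥-elim (¬Pk Pi)
crossing P P? {k = suc k} i≤k Pi ¬Pk with ℕ.m≤n⇒m<n∨m≡n i≤k
... | inj₂ refl = ⊥-elim (¬Pk Pi)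
... | inj₁ (s≤s i≤k-1) with P? k
...   | yes Pk-1 = k , i≤k-1 , ℕ.≤-refl , Pk-1 , ¬Pk
...   | no ¬Pk-1 with crossing P P? i≤k-1 Pi ¬Pk-1
...     | t , i≤t , t<k-1 , Pt , ¬Pt+1 = t , i≤t , ℕ.m≤n⇒m≤1+n t<k-1 , Pt , ¬Pt+1

crossingFin : ∀ {n} (Q : Pred (Fin n) 0ℓ) → Decidable Q → ∀ {i k} → i Fin.≤ k → Q i → ¬ Q k →
              ∃₂ λ t t′ → toℕ t′ ≡ suc (toℕ t) × i Fin.≤ t × t′ Fin.≤ k × Q t × ¬ Q t′
crossingFin {n} Q Q? {i} {k} i≤k Qi ¬Qk
  with crossing AtIndex AtIndex? i≤k (λ f f≡i → subst Q (sym (Fin.toℕ-injective f≡i)) Qi)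
                                     (λ all → ¬Qk (all k refl))
  where
  AtIndex : Pred ℕ 0ℓ
  AtIndex a = ∀ f → toℕ f ≡ a → Q f
  AtIndex? : Decidable AtIndex
  AtIndex? a = Fin.all? (λ f → (toℕ f ℕ.≟ a) →-dec Q? f)
... | t , i≤t , t<k , Pt , ¬Pt+1 =
  fromℕ< t<n , fromℕ< t+1<n , toℕ-t′ , subst (toℕ i ℕ.≤_) (sym toℕ-t) i≤t ,
  subst (ℕ._≤ toℕ k) (sym (Fin.toℕ-fromℕ< t+1<n)) t<k , Pt _ toℕ-t ,
  λ Qt′ → ¬Pt+1 λ f f≡ → subst Q (Fin.toℕ-injective (trans (Fin.toℕ-fromℕ< t+1<n) (sym f≡))) Qt′
  where
  t+1<n : suc t ℕ.< n
  t+1<n = ℕ.<-≤-trans (s≤s t<k) (Fin.toℕ<n k)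
  t<n : t ℕ.< n
  t<n = ℕ.<-trans (ℕ.n<1+n t) t+1<n
  toℕ-t : toℕ (fromℕ< t<n) ≡ t
  toℕ-t = Fin.toℕ-fromℕ< t<n
  toℕ-t′ : toℕ (fromℕ< t+1<n) ≡ suc (toℕ (fromℕ< t<n))
  toℕ-t′ = trans (Fin.toℕ-fromℕ< t+1<n) (cong suc (sym toℕ-t))

module _ {n : ℕ} (π : Fin n ↔ Fin n) (p : Parent n) where

  open Inverse π using (to; from; strictlyInverseˡ; strictlyInverseʳ)

  T : Fin n → Fin n → Set
  T = Induced π p

  InRange : Pred (Fin n) 0ℓ
  InRange v = ∃ λ u → p u ≡ just v

  descent⇒¬Forward : ∀ {u w} → T u w → w Fin.< u → ¬ Forward π p w u
  descent⇒¬Forward (inj₁ (u<w , _)) w<u = ⊥-elim (ℕ.<-asym u<w w<u)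
  descent⇒¬Forward (inj₂ (_ , ¬fw)) _   = ¬fw

  ascent⇒Forward : ∀ {w x} → T w x → w Fin.< x → Forward π p w x
  ascent⇒Forward (inj₁ (_ , fw))    _   = fw
  ascent⇒Forward (inj₂ (x<w , _)) w<x = ⊥-elim (ℕ.<-asym x<w w<x)

  RangeVertexBetween : Fin n → Fin n → Set
  RangeVertexBetween u v = ∃ λ j → InRange j × from u Fin.< from j × from j Fin.≤ from v

  descent-ascent⇒rangeVertexBetween : ∀ {u w x} → T u w → w Fin.< u → T w x → w Fin.< x →
                                      RangeVertexBetween u x
  descent-ascent⇒rangeVertexBetween tuw w<u twx w<x with ascent⇒Forward twx w<x
  ... | j , pw≡j , j≤x =
    j , (_ , pw≡j) , ℕ.≰⇒> (λ j≤u → descent⇒¬Forward tuw w<u (j , pw≡j , j≤u)) , j≤x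

  altWalk⇒rangeVertexBetween : ∀ {u v} → AltWalk T u v → RangeVertexBetween u v
  altWalk⇒rangeVertexBetween (last tuw w<u twx w<x) =
    descent-ascent⇒rangeVertexBetween tuw w<u twx w<x
  altWalk⇒rangeVertexBetween (more tuw w<u twx w<x walk)
    with descent-ascent⇒rangeVertexBetween tuw w<u twx w<x | altWalk⇒rangeVertexBetween walk
  ... | j , j∈p , u<j , j≤x | _ , _ , x<j′ , j′≤v =
    j , j∈p , u<j , ℕ.≤-trans j≤x (ℕ.<⇒≤ (ℕ.<-≤-trans x<j′ j′≤v))

  altWalk⇒from< : ∀ {u v} → AltWalk T u v → from u Fin.< from v
  altWalk⇒from< walk with altWalk⇒rangeVertexBetween walk
  ... | _ , _ , u<j , j≤v = ℕ.<-≤-trans u<j j≤v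

  parent⇒altWalk : ∀ {u m v} → p u ≡ just v → u Fin.< v → u Fin.< m → from m Fin.< from v →
                   AltWalk T m v
  parent⇒altWalk {u} {m} {v} pu≡v u<v u<m m<v =
    last (inj₂ (u<m , ¬forward)) u<m (inj₁ (u<v , (v , pu≡v , ℕ.≤-refl))) u<v
    where
    ¬forward : ¬ Forward π p u m
    ¬forward (j , pu≡j , j≤m) with Maybe.just-injective (trans (sym pu≡j) pu≡v)
    ... | refl = ℕ.<⇒≱ m<v j≤m

  from-to-≤ : ∀ {i j} → i Fin.≤ j → from (to i) Fin.≤ from (to j)
  from-to-≤ {i} {j} = subst₂ Fin._≤_ (sym (strictlyInverseʳ i)) (sym (strictlyInverseʳ j))

  from-to-< : ∀ {i j} → i Fin.< j → from (to i) Fin.< from (to j)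
  from-to-< {i} {j} = subst₂ Fin._<_ (sym (strictlyInverseʳ i)) (sym (strictlyInverseʳ j))

  last-isMaximal : ∀ k → IsMaximalIn T (Prefix to k) (to k)
  last-isMaximal k = (k , ℕ.≤-refl , refl) , maximal
    where
    maximal : ∀ x → Prefix to k x → to k ⪯[ T ] x → x ≡ to k
    maximal x _                  (inj₁ k≡x)  = sym k≡x
    maximal x (j , j≤k , refl) (inj₂ walk) = ⊥-elim (ℕ.<⇒≱ (altWalk⇒from< walk) (from-to-≤ j≤k))

  -- A walk from λ(i) into the prefix passes a range vertex at a position in (i, j], i.e. λ(j).
  beforeUnreachedVertex-isMaximal : ∀ {i j} → toℕ j ≡ suc (toℕ i) → ¬ InRange (to j) →
                                    IsMaximalIn T (Prefix to j) (to i)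
  beforeUnreachedVertex-isMaximal {i} {j} j≡i+1 ∉range = (i , i≤j , refl) , maximal
    where
    i≤j : i Fin.≤ j
    i≤j = subst (toℕ i ℕ.≤_) (sym j≡i+1) (ℕ.n≤1+n (toℕ i))
    maximal : ∀ x → Prefix to j x → to i ⪯[ T ] x → x ≡ to i
    maximal x _                  (inj₁ i≡x)  = sym i≡x
    maximal x (j′ , j′≤j , refl) (inj₂ walk) with altWalk⇒rangeVertexBetween walk
    ... | r , r∈p , i<r , r≤j′ = ⊥-elim (∉range (subst InRange to-r≡to-j r∈p))
      where
      r≡j : from r ≡ j
      r≡j = Fin.toℕ-injective (ℕ.≤-antisym
        (ℕ.≤-trans (subst (λ z → from r Fin.≤ z) (strictlyInverseʳ j′) r≤j′) j′≤j)
        (subst (ℕ._≤ toℕ (from r)) (sym j≡i+1) (subst (Fin._< from r) (strictlyInverseʳ i) i<r)))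
      to-r≡to-j : r ≡ to j
      to-r≡to-j = trans (sym (strictlyInverseˡ r)) (cong to r≡j)

  largestMaximal⇒descentsInRange : IsLargestMaximalRepresentation π p → DescentsInRange π p
  largestMaximal⇒descentsInRange largest i j j≡i+1 descent
    with Fin.any? (λ u → Maybe.≡-dec Fin._≟_ (p u) (just (to j)))
  ... | yes inRange = inRange
  ... | no ∉range   =
    ⊥-elim (ℕ.<⇒≱ descent (proj₂ (largest j) (to i) (beforeUnreachedVertex-isMaximal j≡i+1 ∉range)))

  descentsInRange⇒largestMaximal : ParentValid p → DescentsInRange π p →
                                   IsLargestMaximalRepresentation π p
  descentsInRange⇒largestMaximal valid descents k = last-isMaximal k , below
    where
    below : ∀ m → IsMaximalIn T (Prefix to k) m → m Fin.≤ to k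
    below m ((i , i≤k , refl) , maximal) with to i Fin.≤? to k
    ... | yes λi≤λk = λi≤λk
    ... | no  λi≰λk
      with crossingFin (λ f → to i Fin.≤ to f) (λ f → to i Fin.≤? to f) i≤k ℕ.≤-refl λi≰λk
    ... | t , t′ , t′≡t+1 , i≤t , t′≤k , λi≤λt , λi≰λt′ with descents t t′ t′≡t+1 λt′<λt
      where
      λt′<λt : to t′ Fin.< to t
      λt′<λt = ℕ.<-≤-trans (ℕ.≰⇒> λi≰λt′) λi≤λt
    ... | u , pu≡λt′ = ⊥-elim (ℕ.<-irrefl (cong toℕ λt′≡λi) λt′<λi)
      where
      λt′<λi : to t′ Fin.< to i
      λt′<λi = ℕ.≰⇒> λi≰λt′
      u<λt′ : u Fin.< to t′
      u<λt′ = valid u (to t′) pu≡λt′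
      i<t′ : from (to i) Fin.< from (to t′)
      i<t′ = from-to-< (subst (toℕ i ℕ.<_) (sym t′≡t+1) (s≤s i≤t))
      λt′≡λi : to t′ ≡ to i
      λt′≡λi = maximal (to t′) (t′ , t′≤k , refl)
                 (inj₂ (parent⇒altWalk pu≡λt′ u<λt′ (ℕ.<-trans u<λt′ λt′<λi) i<t′))

theorem5p3 : (n : ℕ) (lam : Fin n ↔ Fin n) (p : Parent n) → ParentValid p →
    IsLargestMaximalRepresentation lam p ⇔ DescentsInRange lam p
theorem5p3 n lam p valid =
  mk⇔ (largestMaximal⇒descentsInRange lam p) (descentsInRange⇒largestMaximal lam p valid)
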